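{- Let $T$ be a numerical semigroup with minimal system of generators $\operatorname{G}(T)=\{n_1,\ldots,n_r\}$, let $d\ge1$, and let $S=\{\mathbf{a}\in\mathbb{N}^d:|\mathbf{a}|\in T\}$ be the $T$-graded GNS. Then the minimal system of generators of $S$ is $\operatorname{G}(S)=\bigcup_{i=1}^rG_{n_i}$, where $G_k=\{\mathbf{x}\in\mathbb{N}^d:|\mathbf{x}|=k\}$.
   Context: $\mathbb{N}$ is the set of non-negative integers; $|\mathbf{x}|$ is the sum of the coordinates of $\mathbf{x}\in\mathbb{N}^d$. A GNS is a submonoid of $\mathbb{N}^d$ with finite complement; a numerical semigroup is the case $d=1$. Every GNS has a unique finite minimal system of generators (a monoid generating set no proper subset of which generates). -}

module Defs where

open import Data.Nat using (ℕ; zero; suc; _+_; _≤_)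
open import Data.Vec using (Vec; replicate; zipWith; sum)
open import Data.List using (List)
open import Data.List.Membership.Propositional using (_∈_)
open import Data.Product using (Σ; ∃; _×_)
open import Relation.Nullary using (¬_)
open import Relation.Binary.PropositionalEquality using (_≡_)

data Gen {A : Set} (e : A) (_⊕_ : A → A → A) (X : A → Set) : A → Set where
  gen-zero : Gen e _⊕_ X e
  gen-inj  : ∀ {a} → X a → Gen e _⊕_ X a
  gen-add  : ∀ {a b} → Gen e _⊕_ X a → Gen e _⊕_ X b → Gen e _⊕_ X (a ⊕ b)

IsSubmonoid : {A : Set} (e : A) (_⊕_ : A → A → A) (M : A → Set) → Set
IsSubmonoid {A} e _⊕_ M = M e × (∀ {a b : A} → M a → M b → M (a ⊕ b))

IsGeneratingSet : {A : Set} (e : A) (_⊕_ : A → A → A) (M X : A → Set) → Set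
IsGeneratingSet {A} e _⊕_ M X = (∀ {a : A} → X a → M a) × (∀ {a : A} → M a → Gen e _⊕_ X a)

IsMinimalSystemOfGenerators : {A : Set} (e : A) (_⊕_ : A → A → A) (M X : A → Set) → Set₁
IsMinimalSystemOfGenerators {A} e _⊕_ M X =
  IsGeneratingSet e _⊕_ M X ×
  ((Y : A → Set) → (∀ {a : A} → Y a → X a) → (∃ λ a → X a × ¬ Y a) →
     ¬ IsGeneratingSet e _⊕_ M Y)

IsNumericalSemigroup : (ℕ → Set) → Set
IsNumericalSemigroup T =
  IsSubmonoid 0 _+_ T × (Σ (List ℕ) λ L → ∀ (n : ℕ) → ¬ T n → n ∈ L)

𝟎 : (d : ℕ) → Vec ℕ d
𝟎 d = replicate d 0

_⊞_ : {d : ℕ} → Vec ℕ d → Vec ℕ d → Vec ℕ d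
_⊞_ = zipWith _+_

∣_∣ : {d : ℕ} → Vec ℕ d → ℕ
∣ x ∣ = sum x

Graded : (d : ℕ) → (ℕ → Set) → Vec ℕ d → Set
Graded d T a = T ∣ a ∣

G : (d : ℕ) → ℕ → Vec ℕ d → Set
G d k x = ∣ x ∣ ≡ k

⋃G : (d : ℕ) → List ℕ → Vec ℕ d → Set
⋃G d ns x = Σ ℕ λ n → n ∈ ns × G d n x

{-# OPTIONS --safe #-}
-- A minimal generator n of T is irreducible: it is not a sum of two nonzero elements of T
-- (otherwise both summands are smaller than n, hence generated without n, and n would be
-- redundant). The vectors of norm n are then irreducible in S, because the norm is additive
-- and only 𝟎 has norm 0; conversely, a vector whose norm is a sum of minimal generators
-- splits coordinatewise into vectors of those norms, so these vectors generate S.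
module Submission where

open import Defs
open import Data.Nat using (ℕ; zero; suc; _+_; _≤_; _<_; _≟_)
open import Data.Nat.Properties
open import Data.List using (List)
open import Data.List.Membership.Propositional using (_∈_)
open import Data.Vec using (Vec; []; _∷_)
open import Data.Vec.Properties using (≡-dec; zipWith-identityˡ; zipWith-identityʳ)
open import Data.Product using (∃; ∃₂; _×_; _,_; proj₁; proj₂)
open import Data.Sum using (_⊎_; inj₁; inj₂)
open import Relation.Nullary using (¬_; yes; no)
open import Relation.Binary.Definitions using (DecidableEquality)
open import Relation.Binary.PropositionalEquality
open import Algebra.Properties.CommutativeSemigroup +-commutativeSemigroup using (interchange)

_∖_ : {A : Set} → (A → Set) → A → A → Set
(X ∖ x) a = X a × a ≢ x

module _ {A : Set} {e : A} {_⊕_ : A → A → A} where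

  Gen-mono : ∀ {X Y : A → Set} → (∀ {a} → X a → Y a) →
             ∀ {a} → Gen e _⊕_ X a → Gen e _⊕_ Y a
  Gen-mono X⊆Y gen-zero      = gen-zero
  Gen-mono X⊆Y (gen-inj x)   = gen-inj (X⊆Y x)
  Gen-mono X⊆Y (gen-add g h) = gen-add (Gen-mono X⊆Y g) (Gen-mono X⊆Y h)

  Gen⊆submonoid : ∀ {M X : A → Set} → IsSubmonoid e _⊕_ M → (∀ {a} → X a → M a) →
                  ∀ {a} → Gen e _⊕_ X a → M a
  Gen⊆submonoid (M-e , _)   X⊆M gen-zero      = M-e
  Gen⊆submonoid _           X⊆M (gen-inj x)   = X⊆M x
  Gen⊆submonoid M@(_ , M-⊕) X⊆M (gen-add g h) =
    M-⊕ (Gen⊆submonoid M X⊆M g) (Gen⊆submonoid M X⊆M h)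

  Gen-cases : DecidableEquality A → (∀ a → e ⊕ a ≡ a) → (∀ a → a ⊕ e ≡ a) →
              ∀ {X a} → Gen e _⊕_ X a →
              a ≡ e ⊎ X a ⊎
              ∃₂ λ b c → Gen e _⊕_ X b × Gen e _⊕_ X c × b ≢ e × c ≢ e × a ≡ b ⊕ c
  Gen-cases _≟ᴬ_ idˡ idʳ gen-zero    = inj₁ refl
  Gen-cases _≟ᴬ_ idˡ idʳ (gen-inj x) = inj₂ (inj₁ x)
  Gen-cases _≟ᴬ_ idˡ idʳ (gen-add {b} {c} g h) with b ≟ᴬ e | c ≟ᴬ e
  ... | yes refl | _        rewrite idˡ c = Gen-cases _≟ᴬ_ idˡ idʳ h
  ... | no _     | yes refl rewrite idʳ b = Gen-cases _≟ᴬ_ idˡ idʳ g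
  ... | no b≢e   | no c≢e   = inj₂ (inj₂ (b , c , g , h , b≢e , c≢e , refl))

  Gen-drop : DecidableEquality A → ∀ {X x} → Gen e _⊕_ (X ∖ x) x →
             ∀ {a} → Gen e _⊕_ X a → Gen e _⊕_ (X ∖ x) a
  Gen-drop _≟ᴬ_ gx gen-zero = gen-zero
  Gen-drop _≟ᴬ_ {x = x} gx (gen-inj {a} xa) with a ≟ᴬ x
  ... | yes refl = gx
  ... | no a≢x   = gen-inj (xa , a≢x)
  Gen-drop _≟ᴬ_ gx (gen-add g h) = gen-add (Gen-drop _≟ᴬ_ gx g) (Gen-drop _≟ᴬ_ gx h)

  minimal⇒irredundant : DecidableEquality A → ∀ {M X x} →
                        IsMinimalSystemOfGenerators e _⊕_ M X → X x → ¬ Gen e _⊕_ (X ∖ x) x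
  minimal⇒irredundant _≟ᴬ_ {X = X} {x} ((X⊆M , M⊆GenX) , minimal) x∈X gx =
    minimal (X ∖ x) proj₁ (x , x∈X , λ (_ , x≢x) → x≢x refl)
      ((λ (y∈X , _) → X⊆M y∈X) , λ Ma → Gen-drop _≟ᴬ_ gx (M⊆GenX Ma))

  IsMinimalSystemOfGenerators-resp : ∀ {M X Y : A → Set} →
    (∀ {a} → X a → Y a) → (∀ {a} → Y a → X a) →
    IsMinimalSystemOfGenerators e _⊕_ M X → IsMinimalSystemOfGenerators e _⊕_ M Y
  IsMinimalSystemOfGenerators-resp X⊆Y Y⊆X ((X⊆M , M⊆GenX) , minimal) =
    ((λ y → X⊆M (Y⊆X y)) , λ Ma → Gen-mono X⊆Y (M⊆GenX Ma)) ,
    λ Z Z⊆Y (a , Ya , a∉Z) → minimal Z (λ z → Y⊆X (Z⊆Y z)) (a , Y⊆X Ya , a∉Z)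

Gen-bounded : ∀ {X m} → Gen 0 _+_ X m → Gen 0 _+_ (λ x → X x × x ≤ m) m
Gen-bounded gen-zero    = gen-zero
Gen-bounded (gen-inj x) = gen-inj (x , ≤-refl)
Gen-bounded (gen-add {a} {b} g h) =
  gen-add (Gen-mono (λ (x , x≤a) → x , ≤-trans x≤a (m≤m+n a b)) (Gen-bounded g))
          (Gen-mono (λ (x , x≤b) → x , ≤-trans x≤b (m≤n+m b a)) (Gen-bounded h))

module _ {T X : ℕ → Set} (minimal : IsMinimalSystemOfGenerators 0 _+_ T X) where

  0∉minimal : ¬ X 0
  0∉minimal X0 = minimal⇒irredundant _≟_ minimal X0 gen-zero

  minimal-irreducible : ∀ {n u v} → X n → T u → T v → u ≢ 0 → v ≢ 0 → n ≢ u + v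
  minimal-irreducible {u = u} {v} Xn Tu Tv u≢0 v≢0 refl =
    minimal⇒irredundant _≟_ minimal Xn
      (gen-add (generatedBelow (m<m+n u (n≢0⇒n>0 v≢0)) Tu)
               (generatedBelow (m<n+m v (n≢0⇒n>0 u≢0)) Tv))
    where
    generatedBelow : ∀ {m} → m < u + v → T m → Gen 0 _+_ (X ∖ (u + v)) m
    generatedBelow m<n Tm =
      Gen-mono (λ (Xx , x≤m) → Xx , <⇒≢ (≤-<-trans x≤m m<n))
               (Gen-bounded (proj₂ (proj₁ minimal) Tm))

sum-𝟎 : ∀ {d} → ∣ 𝟎 d ∣ ≡ 0
sum-𝟎 {zero}  = refl
sum-𝟎 {suc d} = sum-𝟎 {d}

sum-⊞ : ∀ {d} (a b : Vec ℕ d) → ∣ a ⊞ b ∣ ≡ ∣ a ∣ + ∣ b ∣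
sum-⊞ []      []      = refl
sum-⊞ (x ∷ a) (y ∷ b) = trans (cong (x + y +_) (sum-⊞ a b)) (interchange x y ∣ a ∣ ∣ b ∣)

sum≡0⇒𝟎 : ∀ {d} (a : Vec ℕ d) → ∣ a ∣ ≡ 0 → a ≡ 𝟎 d
sum≡0⇒𝟎 []      _   = refl
sum≡0⇒𝟎 (x ∷ a) a≡0 with m+n≡0⇒m≡0 x a≡0
... | refl = cong (0 ∷_) (sum≡0⇒𝟎 a a≡0)

⊞-identityˡ : ∀ {d} (a : Vec ℕ d) → 𝟎 d ⊞ a ≡ a
⊞-identityˡ = zipWith-identityˡ +-identityˡ

⊞-identityʳ : ∀ {d} (a : Vec ℕ d) → a ⊞ 𝟎 d ≡ a
⊞-identityʳ = zipWith-identityʳ +-identityʳ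

sum-split : ∀ {d} (a : Vec ℕ d) (p q : ℕ) → ∣ a ∣ ≡ p + q →
            ∃₂ λ b c → b ⊞ c ≡ a × ∣ b ∣ ≡ p × ∣ c ∣ ≡ q
sum-split []          zero    zero refl = [] , [] , refl , refl , refl
sum-split {d} (x ∷ a) zero    q    a≡q  = 𝟎 d , x ∷ a , ⊞-identityˡ (x ∷ a) , sum-𝟎 {d} , a≡q
sum-split (zero ∷ a)  (suc p) q    a≡pq with sum-split a (suc p) q a≡pq
... | b , c , refl , b≡p , c≡q = 0 ∷ b , 0 ∷ c , refl , b≡p , c≡q
sum-split (suc x ∷ a) (suc p) q    a≡pq with sum-split (x ∷ a) p q (suc-injective a≡pq)
... | y ∷ b , z ∷ c , refl , refl , refl = suc y ∷ b , z ∷ c , refl , refl , refl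

module _ {T : ℕ → Set} (T-submonoid : IsSubmonoid 0 _+_ T) {d : ℕ} where

  Graded-isSubmonoid : IsSubmonoid (𝟎 d) _⊞_ (Graded d T)
  Graded-isSubmonoid =
    subst T (sym (sum-𝟎 {d})) (proj₁ T-submonoid) ,
    λ {a} {b} Ta Tb → subst T (sym (sum-⊞ a b)) (proj₂ T-submonoid Ta Tb)

  Gen-lift : ∀ {X m} → Gen 0 _+_ X m → (a : Vec ℕ d) → ∣ a ∣ ≡ m →
             Gen (𝟎 d) _⊞_ (λ b → X ∣ b ∣) a
  Gen-lift gen-zero    a a≡0 = subst (Gen (𝟎 d) _⊞_ _) (sym (sum≡0⇒𝟎 a a≡0)) gen-zero
  Gen-lift (gen-inj x) a refl = gen-inj x
  Gen-lift (gen-add {p} {q} g h) a a≡pq with sum-split a p q a≡pq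
  ... | b , c , refl , b≡p , c≡q = gen-add (Gen-lift g b b≡p) (Gen-lift h c c≡q)

  Graded-minimal : ∀ {X} → IsMinimalSystemOfGenerators 0 _+_ T X →
                   IsMinimalSystemOfGenerators (𝟎 d) _⊞_ (Graded d T) (λ a → X ∣ a ∣)
  Graded-minimal {X} minimal@((X⊆T , T⊆GenX) , _) =
    (X⊆T , λ {a} Ta → Gen-lift (T⊆GenX Ta) a refl) , irredundant
    where
    irredundant : (Y : Vec ℕ d → Set) → (∀ {a} → Y a → X ∣ a ∣) →
                  (∃ λ a → X ∣ a ∣ × ¬ Y a) → ¬ IsGeneratingSet (𝟎 d) _⊞_ (Graded d T) Y
    irredundant Y Y⊆X (a , Xa , a∉Y) (_ , S⊆GenY)
      with Gen-cases (≡-dec _≟_) ⊞-identityˡ ⊞-identityʳ (S⊆GenY {a} (X⊆T Xa))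
    ... | inj₁ refl      = 0∉minimal minimal (subst X (sum-𝟎 {d}) Xa)
    ... | inj₂ (inj₁ Ya) = a∉Y Ya
    ... | inj₂ (inj₂ (b , c , gb , gc , b≢𝟎 , c≢𝟎 , refl)) =
      minimal-irreducible minimal Xa (graded gb) (graded gc)
        (λ b≡0 → b≢𝟎 (sum≡0⇒𝟎 b b≡0)) (λ c≡0 → c≢𝟎 (sum≡0⇒𝟎 c c≡0)) (sum-⊞ b c)
      where
      graded : ∀ {x} → Gen (𝟎 d) _⊞_ Y x → Graded d T x
      graded = Gen⊆submonoid Graded-isSubmonoid (λ Yx → X⊆T (Y⊆X Yx))

theorem4p3 : (T : ℕ → Set) → IsNumericalSemigroup T →
    (ns : List ℕ) → IsMinimalSystemOfGenerators 0 _+_ T (λ n → n ∈ ns) →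
    (d : ℕ) → 1 ≤ d →
    IsMinimalSystemOfGenerators (𝟎 d) _⊞_ (Graded d T) (⋃G d ns)
theorem4p3 T (T-submonoid , _) ns minimal d _ =
  IsMinimalSystemOfGenerators-resp
    (λ {a} a∈ns → ∣ a ∣ , a∈ns , refl)
    (λ { (_ , n∈ns , refl) → n∈ns })
    (Graded-minimal T-submonoid minimal)
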